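{- (i) For every context $\Gamma$, variables $y, w$ and term $A$: if $\Gamma\ \mathrm{ok}$, $w\notin\mathrm{dom}\,\Gamma$ and $(y,A)\in\Gamma$, then $w\notin\mathrm{fv}\,A$. (ii) For every context $\Gamma$, terms $M, A$ and variable $w$: if $w\notin\mathrm{dom}\,\Gamma$ and $\Gamma\vdash M:A$, then $w\notin\mathrm{fv}(M\cdot A)$.
   Context: Variables $\mathcal{V}$: a type with decidable equality and maps $\mathrm{encode}:\mathcal{V}\to\mathbb{N}$, $\mathrm{decode}:\mathbb{N}\to\mathcal{V}$ with $\mathrm{encode}(\mathrm{decode}\,n)=n$. Constants $\mathcal{C}$: any type. Terms: $\mathsf{c}\,k$, $\mathsf{v}\,x$, $\lambda[x:A]M$, $\Pi[x:A]B$, $M\cdot N$. Free-variable list: $\mathrm{fv}(\mathsf{c}\,k)=[\,]$, $\mathrm{fv}(\mathsf{v}\,x)=[x]$, $\mathrm{fv}(\lambda[x:A]M)=\mathrm{fv}\,A\mathbin{++}(\mathrm{fv}\,M-x)$, likewise $\Pi$, $\mathrm{fv}(M\cdot N)=\mathrm{fv}\,M\mathbin{++}\mathrm{fv}\,N$ ($xs-x$ removes all occurrences of $x$). Substitutions $\sigma:\mathcal{V}\to\Lambda$; $\iota\,x=\mathsf{v}\,x$; $(\sigma,x:=N)$ sends $x$ to $N$, $y\neq x$ to $\sigma\,y$. Fix $\chi':\mathrm{List}\,\mathbb{N}\to\mathbb{N}$ with $\chi'(ns)\notin ns$; $X'(xs)=\mathrm{decode}(\chi'(\mathrm{map\ encode}\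 xs))$; $X(\sigma,xs)=X'$(concatenation of $\mathrm{fv}(\sigma\,y)$ for $y$ in $xs$). Substitution: $\mathsf{c}\,k\bullet\sigma=\mathsf{c}\,k$, $\mathsf{v}\,x\bullet\sigma=\sigma\,x$, $(M\cdot N)\bullet\sigma=(M\bullet\sigma)\cdot(N\bullet\sigma)$, $(\lambda[x:A]M)\bullet\sigma=\lambda[y:A\bullet\sigma](M\bullet(\sigma,x:=\mathsf{v}\,y))$ with $y=X(\sigma,\mathrm{fv}\,M-x)$, analogously for $\Pi$ (with $y=X(\sigma,\mathrm{fv}\,B-x)$). $M[x:=N]=M\bullet(\iota,x:=N)$. Alpha-conversion $\sim_\alpha$: inductive, $\mathsf{c}\,k\sim_\alpha\mathsf{c}\,k$, $\mathsf{v}\,x\sim_\alpha\mathsf{v}\,x$, congruence for application, and $\lambda[x:A]M\sim_\alpha\lambda[x':A']M'$ whenever $A\sim_\alpha A'$, $y\notin\mathrm{fv}\,M-x$, $y\notin\mathrm{fv}\,M'-x'$ and $M[x:=\mathsf{v}\,y]=M'[x':=\mathsf{v}\,y]$ syntactically, for some $y$ (same for $\Pi$). Beta: the contextual closure of a relation $S$ is the least relation containing $S$ and closed under rewriting in the body or annotation of $\lambda$, in the codomain or domain of $\Pi$, and in either side of an application; $\to_\beta$ is the contextual closure of $(\lambda[x:A]M)\cdot N\ \triangleright\ M[x:=N]$; $\simeq_\beta$ is the reflexive–symmetric–transitive closure of $\sim_\alpha\cup\to_\beta$. PTS: fix $\mathcal{A}\subseteq\mathcal{C}^2$ (axioms)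 and $\mathcal{R}\subseteq\mathcal{C}^3$ (rules). A context is a list of pairs $(x,A)$; $\Gamma,x:A$ denotes $(x,A)::\Gamma$; $\mathrm{dom}\,\Gamma$ is the list of first components. The judgments $\Gamma\ \mathrm{ok}$ and $\Gamma\vdash M:A$ are mutually inductively defined by: (nil) $[\,]\ \mathrm{ok}$; (cons) if $\Gamma\ \mathrm{ok}$, $\Gamma\vdash A:\mathsf{c}\,s$ and $x\notin\mathrm{dom}\,\Gamma$ then $(\Gamma,x:A)\ \mathrm{ok}$; (sort) if $\Gamma\ \mathrm{ok}$ and $\mathcal{A}\,s_1\,s_2$ then $\Gamma\vdash\mathsf{c}\,s_1:\mathsf{c}\,s_2$; (prod) if $\Gamma\vdash A:\mathsf{c}\,s_1$, for every $y\notin\mathrm{dom}\,\Gamma$ we have $\Gamma,y:A\vdash B[x:=\mathsf{v}\,y]:\mathsf{c}\,s_2$, and $\mathcal{R}\,s_1\,s_2\,s_3$, then $\Gamma\vdash\Pi[x:A]B:\mathsf{c}\,s_3$; (var) if $\Gamma\ \mathrm{ok}$ and $(x,A)\in\Gamma$ then $\Gamma\vdash\mathsf{v}\,x:A$; (abs) if $\Gamma\vdash A:\mathsf{c}\,s_1$, for every $z\notin\mathrm{dom}\,\Gamma$ both $\Gamma,z:A\vdash B[y:=\mathsf{v}\,z]:\mathsf{c}\,s_2$ and $\Gamma,z:A\vdash M[x:=\mathsf{v}\,z]:B[y:=\mathsf{v}\,z]$, and $\mathcal{R}\,s_1\,s_2\,s_3$, then $\Gamma\vdash\lambda[x:A]M:\Pi[y:A]B$;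 (app) if $\Gamma\vdash M:\Pi[x:A]B$, $\Gamma\vdash N:A$ and $\Gamma\vdash B[x:=N]:\mathsf{c}\,s$, then $\Gamma\vdash M\cdot N:B[x:=N]$; (conv) if $\Gamma\vdash M:A$, $A\simeq_\beta B$ and $\Gamma\vdash B:\mathsf{c}\,s$ then $\Gamma\vdash M:B$. -}

module Defs where

open import Data.Nat using (ℕ)
open import Data.List using (List; []; _∷_; _++_; map; filter; concatMap)
open import Data.List.Membership.Propositional using (_∈_; _∉_)
open import Data.Product using (_×_; _,_; proj₁; ∃)
open import Relation.Nullary using (¬?)
open import Relation.Binary.Definitions using (DecidableEquality)
open import Relation.Binary.PropositionalEquality using (_≡_; _≢_)
open import Relation.Binary.Construct.Closure.Equivalence using (EqClosure)
open import Relation.Binary.Construct.Union using (_∪_)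

module PTS
  (V : Set) (_≟_ : DecidableEquality V)
  (encode : V → ℕ) (decode : ℕ → V)
  (encode-decode : ∀ n → encode (decode n) ≡ n)
  (C : Set)
  (χ' : List ℕ → ℕ) (χ'-fresh : ∀ ns → χ' ns ∉ ns)
  (Ax : C → C → Set) (Rl : C → C → C → Set)
  where

  infixl 30 _·_
  infix 25 _[_≔_]
  infix 25 _•_
  infix 4 _⊢_∶_
  infixl 10 _,,_∶_
  infix 4 _ok

  data Term : Set where
    c   : C → Term
    v   : V → Term
    lam : V → Term → Term → Term   -- λ[x:A]M
    pi  : V → Term → Term → Term   -- Π[x:A]B
    _·_ : Term → Term → Term

  _-_ : List V → V → List V
  xs - x = filter (λ y → ¬? (y ≟ x)) xs

  fv : Term → List V
  fv (c k) = []
  fv (v x) = x ∷ []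
  fv (lam x A M) = fv A ++ (fv M - x)
  fv (pi x A B) = fv A ++ (fv B - x)
  fv (M · N) = fv M ++ fv N

  Subst : Set
  Subst = V → Term

  ι : Subst
  ι x = v x

  _,_≔_ : Subst → V → Term → Subst
  (σ , x ≔ N) y with y ≟ x
  ... | Relation.Nullary.yes _ = N
  ... | Relation.Nullary.no _ = σ y

  X' : List V → V
  X' xs = decode (χ' (map encode xs))

  X : Subst → List V → V
  X σ xs = X' (concatMap (λ y → fv (σ y)) xs)

  _•_ : Term → Subst → Term
  c k • σ = c k
  v x • σ = σ x
  (M · N) • σ = (M • σ) · (N • σ)
  lam x A M • σ = lam y (A • σ) (M • (σ , x ≔ v y))
    where y = X σ (fv M - x)
  pi x A B • σ = pi y (A • σ) (B • (σ , x ≔ v y))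
    where y = X σ (fv B - x)

  _[_≔_] : Term → V → Term → Term
  M [ x ≔ N ] = M • (ι , x ≔ N)

  data _∼α_ : Term → Term → Set where
    α-c   : ∀ k → c k ∼α c k
    α-v   : ∀ x → v x ∼α v x
    α-app : ∀ {M M' N N'} → M ∼α M' → N ∼α N' → (M · N) ∼α (M' · N')
    α-lam : ∀ {x x' A A' M M'} y → A ∼α A' → y ∉ (fv M - x) → y ∉ (fv M' - x')
          → M [ x ≔ v y ] ≡ M' [ x' ≔ v y ] → lam x A M ∼α lam x' A' M'
    α-pi  : ∀ {x x' A A' B B'} y → A ∼α A' → y ∉ (fv B - x) → y ∉ (fv B' - x')
          → B [ x ≔ v y ] ≡ B' [ x' ≔ v y ] → pi x A B ∼α pi x' A' B'

  data Ctx (S : Term → Term → Set) : Term → Term → Set where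
    base  : ∀ {M N} → S M N → Ctx S M N
    lam-body : ∀ {x A M M'} → Ctx S M M' → Ctx S (lam x A M) (lam x A M')
    lam-ann  : ∀ {x A A' M} → Ctx S A A' → Ctx S (lam x A M) (lam x A' M)
    pi-cod   : ∀ {x A B B'} → Ctx S B B' → Ctx S (pi x A B) (pi x A B')
    pi-dom   : ∀ {x A A' B} → Ctx S A A' → Ctx S (pi x A B) (pi x A' B)
    app-l    : ∀ {M M' N} → Ctx S M M' → Ctx S (M · N) (M' · N)
    app-r    : ∀ {M N N'} → Ctx S N N' → Ctx S (M · N) (M · N')

  data _▷β_ : Term → Term → Set where
    β : ∀ x A M N → (lam x A M · N) ▷β (M [ x ≔ N ])

  _→β_ : Term → Term → Set
  _→β_ = Ctx _▷β_

  _≃β_ : Term → Term → Set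
  _≃β_ = EqClosure (_∼α_ ∪ _→β_)

  Context : Set
  Context = List (V × Term)

  dom : Context → List V
  dom = map proj₁

  _,,_∶_ : Context → V → Term → Context
  Γ ,, x ∶ A = (x , A) ∷ Γ

  data _ok : Context → Set
  data _⊢_∶_ : Context → Term → Term → Set

  data _ok where
    nil  : [] ok
    cons : ∀ {Γ x A s} → Γ ok → Γ ⊢ A ∶ c s → x ∉ dom Γ → (Γ ,, x ∶ A) ok

  data _⊢_∶_ where
    sort : ∀ {Γ s₁ s₂} → Γ ok → Ax s₁ s₂ → Γ ⊢ c s₁ ∶ c s₂
    prod : ∀ {Γ x A B s₁ s₂ s₃} → Γ ⊢ A ∶ c s₁
         → (∀ y → y ∉ dom Γ → (Γ ,, y ∶ A) ⊢ B [ x ≔ v y ] ∶ c s₂)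
         → Rl s₁ s₂ s₃ → Γ ⊢ pi x A B ∶ c s₃
    var  : ∀ {Γ x A} → Γ ok → (x , A) ∈ Γ → Γ ⊢ v x ∶ A
    abs  : ∀ {Γ x y A B M s₁ s₂ s₃} → Γ ⊢ A ∶ c s₁
         → (∀ z → z ∉ dom Γ → (Γ ,, z ∶ A) ⊢ B [ y ≔ v z ] ∶ c s₂)
         → (∀ z → z ∉ dom Γ → (Γ ,, z ∶ A) ⊢ M [ x ≔ v z ] ∶ B [ y ≔ v z ])
         → Rl s₁ s₂ s₃ → Γ ⊢ lam x A M ∶ pi y A B
    app  : ∀ {Γ M N x A B s} → Γ ⊢ M ∶ pi x A B → Γ ⊢ N ∶ A
         → Γ ⊢ B [ x ≔ N ] ∶ c s → Γ ⊢ M · N ∶ B [ x ≔ N ]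
    conv : ∀ {Γ M A B s} → Γ ⊢ M ∶ A → A ≃β B → Γ ⊢ B ∶ c s → Γ ⊢ M ∶ B

module Submission where

-- Both parts follow from the stronger fact that the free variables of a well-typed term,
-- of its type, and of every type declared in a well-formed context are declared in the
-- context, by simultaneous induction on derivations. Under a binder the premise holds for
-- every fresh z; take z ≠ w. Renaming the bound variable to z keeps every other free
-- variable (substitution picks its new binder outside the free variables of the substituted
-- terms), so w is free in the instance, hence in z ∷ dom Γ, hence in dom Γ.

open import Defs
open import Data.Empty using (⊥-elim)
open import Data.Nat using (ℕ)
open import Data.List using (List; []; _∷_; _++_; map)
open import Data.List.Membership.Propositional using (_∈_; _∉_)
open import Data.List.Membership.Propositional.Properties
  using (∈-++⁺ˡ; ∈-++⁺ʳ; ∈-++⁻; ∈-filter⁺; ∈-filter⁻; ∈-map⁺; ∈-concatMap⁺)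
open import Data.List.Relation.Binary.Subset.Propositional using (_⊆_)
open import Data.List.Relation.Unary.Any using (here; there)
import Data.List.Relation.Unary.Any as Any
open import Data.Product using (_×_; _,_; proj₁)
open import Data.Sum using (inj₁; inj₂; [_,_]′)
open import Function using (_∘_)
open import Relation.Nullary using (yes; no; ¬?)
open import Relation.Binary.Definitions using (DecidableEquality)
open import Relation.Binary.PropositionalEquality using (_≡_; _≢_; refl; sym; subst)

module FreeVariables
  (V : Set) (_≟_ : DecidableEquality V)
  (encode : V → ℕ) (decode : ℕ → V)
  (encode-decode : ∀ n → encode (decode n) ≡ n)
  (C : Set)
  (χ' : List ℕ → ℕ) (χ'-fresh : ∀ ns → χ' ns ∉ ns)
  (Ax : C → C → Set) (Rl : C → C → C → Set)
  where
  open PTS V _≟_ encode decode encode-decode C χ' χ'-fresh Ax Rl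

  X'-fresh : ∀ xs → X' xs ∉ xs
  X'-fresh xs x∈xs = χ'-fresh (map encode xs)
    (subst (_∈ map encode xs) (encode-decode _) (∈-map⁺ encode x∈xs))

  ∈-remove⁺ : ∀ {z x xs} → z ∈ xs → z ≢ x → z ∈ xs - x
  ∈-remove⁺ {x = x} = ∈-filter⁺ (λ y → ¬? (y ≟ x))

  ∈-remove⁻ : ∀ {z x xs} → z ∈ xs - x → z ∈ xs × z ≢ x
  ∈-remove⁻ {x = x} = ∈-filter⁻ (λ y → ¬? (y ≟ x))

  ++-⊆ : ∀ {xs ys zs : List V} → xs ⊆ zs → ys ⊆ zs → xs ++ ys ⊆ zs
  ++-⊆ {xs} xs⊆zs ys⊆zs = [ xs⊆zs , ys⊆zs ]′ ∘ ∈-++⁻ xs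

  extend-≢ : ∀ σ {x} N {z} → z ≢ x → (σ , x ≔ N) z ≡ σ z
  extend-≢ σ {x} N {z} z≢x with z ≟ x
  ... | yes z≡x = ⊥-elim (z≢x z≡x)
  ... | no _ = refl

  fv-•⁺ : ∀ M σ {z} → z ∈ fv M → fv (σ z) ⊆ fv (M • σ)
  fv-•⁺-binder : ∀ M σ x {z} → z ∈ fv M - x →
    let y = X σ (fv M - x) in fv (σ z) ⊆ fv (M • (σ , x ≔ v y)) - y

  fv-•⁺ (v x) σ (here refl) u∈ = u∈
  fv-•⁺ (M · N) σ z∈ with ∈-++⁻ (fv M) z∈
  ... | inj₁ z∈M = ∈-++⁺ˡ ∘ fv-•⁺ M σ z∈M
  ... | inj₂ z∈N = ∈-++⁺ʳ (fv (M • σ)) ∘ fv-•⁺ N σ z∈N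
  fv-•⁺ (lam x A M) σ z∈ with ∈-++⁻ (fv A) z∈
  ... | inj₁ z∈A = ∈-++⁺ˡ ∘ fv-•⁺ A σ z∈A
  ... | inj₂ z∈M = ∈-++⁺ʳ (fv (A • σ)) ∘ fv-•⁺-binder M σ x z∈M
  fv-•⁺ (pi x A B) σ z∈ with ∈-++⁻ (fv A) z∈
  ... | inj₁ z∈A = ∈-++⁺ˡ ∘ fv-•⁺ A σ z∈A
  ... | inj₂ z∈B = ∈-++⁺ʳ (fv (A • σ)) ∘ fv-•⁺-binder B σ x z∈B

  fv-•⁺-binder M σ x {z} z∈ {u} u∈ with ∈-remove⁻ z∈
  ... | z∈M , z≢x = ∈-remove⁺ u∈M• u≢y
    where
    y = X σ (fv M - x)
    u∈M• : u ∈ fv (M • (σ , x ≔ v y))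
    u∈M• = fv-•⁺ M (σ , x ≔ v y) z∈M
      (subst (λ t → u ∈ fv t) (sym (extend-≢ σ (v y) z≢x)) u∈)
    u≢y : u ≢ y
    u≢y refl = X'-fresh _ (∈-concatMap⁺ (fv ∘ σ) (Any.map (λ { refl → u∈ }) z∈))

  fv-rename⁺ : ∀ M x y {w} → w ∈ fv M - x → w ∈ fv (M [ x ≔ v y ])
  fv-rename⁺ M x y {w} w∈ with ∈-remove⁻ w∈
  ... | w∈M , w≢x = fv-•⁺ M (ι , x ≔ v y) w∈M
    (subst (λ t → w ∈ fv t) (sym (extend-≢ ι (v y) w≢x)) (here refl))

  binder-fv⊆dom : ∀ {Γ : Context} B x →
    (∀ z → z ∉ dom Γ → fv (B [ x ≔ v z ]) ⊆ z ∷ dom Γ) → fv B - x ⊆ dom Γ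
  binder-fv⊆dom {Γ} B x fv⊆ {w} w∈
    with fv⊆ (X' (w ∷ dom Γ)) (X'-fresh (w ∷ dom Γ) ∘ there) (fv-rename⁺ B x _ w∈)
  ... | here w≡z = ⊥-elim (X'-fresh (w ∷ dom Γ) (here (sym w≡z)))
  ... | there w∈Γ = w∈Γ

  ok-fv⊆dom : ∀ {Γ y A} → Γ ok → (y , A) ∈ Γ → fv A ⊆ dom Γ
  ⊢-fv⊆dom : ∀ {Γ M A} → Γ ⊢ M ∶ A → fv (M · A) ⊆ dom Γ
  ⊢-subject-fv⊆dom : ∀ {Γ M A} → Γ ⊢ M ∶ A → fv M ⊆ dom Γ

  ok-fv⊆dom (cons _ ⊢A _) (here refl) = there ∘ ⊢-subject-fv⊆dom ⊢A
  ok-fv⊆dom (cons ok _ _) (there y∈Γ) = there ∘ ok-fv⊆dom ok y∈Γ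

  ⊢-subject-fv⊆dom ⊢M = ⊢-fv⊆dom ⊢M ∘ ∈-++⁺ˡ

  ⊢-fv⊆dom (sort _ _) ()
  ⊢-fv⊆dom (prod {x = x} {B = B} ⊢A ⊢B _) =
    ++-⊆ (++-⊆ (⊢-subject-fv⊆dom ⊢A)
                (binder-fv⊆dom B x (λ z z∉ → ⊢-subject-fv⊆dom (⊢B z z∉))))
         (λ ())
  ⊢-fv⊆dom (var ok x∈Γ) =
    ++-⊆ (λ { (here refl) → ∈-map⁺ proj₁ x∈Γ }) (ok-fv⊆dom ok x∈Γ)
  ⊢-fv⊆dom (abs {x = x} {y} {B = B} {M} ⊢A ⊢B ⊢M _) =
    ++-⊆ (++-⊆ A⊆Γ (binder-fv⊆dom M x (λ z z∉ → ⊢-subject-fv⊆dom (⊢M z z∉))))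
         (++-⊆ A⊆Γ (binder-fv⊆dom B y (λ z z∉ → ⊢-subject-fv⊆dom (⊢B z z∉))))
    where A⊆Γ = ⊢-subject-fv⊆dom ⊢A
  ⊢-fv⊆dom (app ⊢M ⊢N ⊢B) =
    ++-⊆ (++-⊆ (⊢-subject-fv⊆dom ⊢M) (⊢-subject-fv⊆dom ⊢N)) (⊢-subject-fv⊆dom ⊢B)
  ⊢-fv⊆dom (conv ⊢M _ ⊢B) =
    ++-⊆ (⊢-subject-fv⊆dom ⊢M) (⊢-subject-fv⊆dom ⊢B)

corollary1 : (V : Set) (_≟_ : DecidableEquality V)
    (encode : V → ℕ) (decode : ℕ → V)
    (encode-decode : ∀ n → encode (decode n) ≡ n)
    (C : Set)
    (χ' : List ℕ → ℕ) (χ'-fresh : ∀ ns → χ' ns ∉ ns)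
    (Ax : C → C → Set) (Rl : C → C → C → Set) →
    let open PTS V _≟_ encode decode encode-decode C χ' χ'-fresh Ax Rl in
    (∀ (Γ : Context) (y w : V) (A : Term) →
       Γ ok → w ∉ dom Γ → (y , A) ∈ Γ → w ∉ fv A)
    × (∀ (Γ : Context) (M A : Term) (w : V) →
       w ∉ dom Γ → Γ ⊢ M ∶ A → w ∉ fv (M · A))
corollary1 V _≟_ encode decode encode-decode C χ' χ'-fresh Ax Rl =
  (λ Γ y w A ok w∉Γ y∈Γ w∈A → w∉Γ (ok-fv⊆dom ok y∈Γ w∈A)) ,
  (λ Γ M A w w∉Γ ⊢M w∈ → w∉Γ (⊢-fv⊆dom ⊢M w∈))
  where open FreeVariables V _≟_ encode decode encode-decode C χ' χ'-fresh Ax Rl
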